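{- Let $G$ be a finite connected graph and $\mathcal{H}\subseteq E(G)$. Let $\mathcal{C}$ be a contracting set of $G$ with respect to $\mathcal{H}$, let $\mathcal{D}=E(G)\setminus(\mathcal{C}\cup\mathcal{H})$ be the corresponding deleting set, let $e\in\mathcal{C}$ and $f\in\mathcal{D}$. Suppose the triplet $(\mathcal{C},e,f)$ has at least one of the properties (i) $\mathcal{C}\cup\{f\}$ contains a cycle containing $e$; (ii) $\mathcal{D}\cup\{e\}$ contains a cocycle containing $f$. Then $\mathcal{C}'=\{f\}\cup(\mathcal{C}\setminus\{e\})$ is also a contracting set with respect to $\mathcal{H}$. Moreover, if $(\mathcal{C},e,f)$ has property (i) (respectively (ii)), then the triplet $(\mathcal{C}',f,e)$ has property (i) (respectively (ii)), where for $\mathcal{C}'$ the role of $\mathcal{D}$ is played by its deleting set $\mathcal{D}'=E(G)\setminus(\mathcal{C}'\cup\mathcal{H})$.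
   Context: Graphs may have loops and multiple edges. A cycle is the edge set of a circuit (a loop is a cycle); a cocycle is a minimal set of edges whose removal disconnects the connected graph. A contracting set with respect to $\mathcal{H}$ is a set $\mathcal{C}\subseteq E(G)\setminus\mathcal{H}$ that contains no cycle and such that its deleting set $E(G)\setminus(\mathcal{C}\cup\mathcal{H})$ contains no cocycle. -}

module Defs where

open import Data.Nat using (ℕ; suc)
open import Data.Fin using (Fin; zero; suc; inject₁; fromℕ)
open import Data.Fin.Subset using (Subset; _∈_; _⊆_; _∪_; _─_; _-_; ⁅_⁆; ∁; ⊤)
open import Data.Product using (Σ; ∃; _×_; _,_)
open import Data.Sum using (_⊎_)
open import Relation.Nullary using (¬_)
open import Relation.Binary.PropositionalEquality using (_≡_)
open import Relation.Binary.Construct.Closure.ReflexiveTransitive using (Star)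
open import Function.Definitions using (Injective)

-- A finite multigraph (loops and parallel edges allowed):
-- vertices Fin nV, edges Fin nE, each edge has an (unordered) pair of ends.
record Graph : Set where
  field
    nV   : ℕ
    nE   : ℕ
    ends : Fin nE → Fin nV × Fin nV

open Graph public

EdgeSet : Graph → Set
EdgeSet G = Subset (nE G)

Joins : (G : Graph) → Fin (nE G) → Fin (nV G) → Fin (nV G) → Set
Joins G e u v = (ends G e ≡ (u , v)) ⊎ (ends G e ≡ (v , u))

AdjIn : (G : Graph) → EdgeSet G → Fin (nV G) → Fin (nV G) → Set
AdjIn G A u v = Σ (Fin (nE G)) λ e → (e ∈ A) × Joins G e u v

ConnectedIn : (G : Graph) → EdgeSet G → Set
ConnectedIn G A = (u v : Fin (nV G)) → Star (AdjIn G A) u v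

Connected : Graph → Set
Connected G = ConnectedIn G ⊤

-- S is the edge set of a circuit: a closed walk v₀ e₀ v₁ … e_{k-1} v_k = v₀
-- with k ≥ 1, pairwise distinct edges and pairwise distinct v₀ … v_{k-1}.
IsCycle : (G : Graph) → EdgeSet G → Set
IsCycle G S =
  Σ ℕ λ k →
  Σ (Fin (suc (suc k)) → Fin (nV G)) λ vs →
  Σ (Fin (suc k) → Fin (nE G)) λ es →
    Injective _≡_ _≡_ es
    × Injective _≡_ _≡_ (λ i → vs (inject₁ i))
    × vs (fromℕ (suc k)) ≡ vs zero
    × ((i : Fin (suc k)) → Joins G (es i) (vs (inject₁ i)) (vs (suc i)))
    × ((e : Fin (nE G)) → e ∈ S → Σ (Fin (suc k)) λ i → es i ≡ e)
    × ((i : Fin (suc k)) → es i ∈ S)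

Disconnects : (G : Graph) → EdgeSet G → Set
Disconnects G X = ¬ ConnectedIn G (∁ X)

IsCocycle : (G : Graph) → EdgeSet G → Set
IsCocycle G X = Disconnects G X × ((Y : EdgeSet G) → Y ⊆ X → Disconnects G Y → X ⊆ Y)

ContainsCycle : (G : Graph) → EdgeSet G → Set
ContainsCycle G A = Σ (EdgeSet G) λ S → IsCycle G S × S ⊆ A

ContainsCocycle : (G : Graph) → EdgeSet G → Set
ContainsCocycle G A = Σ (EdgeSet G) λ S → IsCocycle G S × S ⊆ A

DeletingSet : (G : Graph) → EdgeSet G → EdgeSet G → EdgeSet G
DeletingSet G H C = ⊤ ─ (C ∪ H)

IsContracting : (G : Graph) → EdgeSet G → EdgeSet G → Set
IsContracting G H C =
  C ⊆ (⊤ ─ H) × ¬ ContainsCycle G C × ¬ ContainsCocycle G (DeletingSet G H C)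

Property-i : (G : Graph) → EdgeSet G → Fin (nE G) → Fin (nE G) → Set
Property-i G C e f = Σ (EdgeSet G) λ S → IsCycle G S × S ⊆ (C ∪ ⁅ f ⁆) × e ∈ S

Property-ii : (G : Graph) → EdgeSet G → EdgeSet G → Fin (nE G) → Fin (nE G) → Set
Property-ii G H C e f =
  Σ (EdgeSet G) λ S → IsCocycle G S × S ⊆ (DeletingSet G H C ∪ ⁅ e ⁆) × f ∈ S

Exchange : (G : Graph) → EdgeSet G → Fin (nE G) → Fin (nE G) → EdgeSet G
Exchange G C e f = ⁅ f ⁆ ∪ (C - e)

-- Two dual facts carry the argument: a cycle and a cocycle never meet in exactly one edge, and an
-- edge whose ends are joined by a path avoiding it lies on a cycle (dually, a set whose removal
-- disconnects G contains a cocycle). Every cycle inside C′ must use f, and every cocycle inside D′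
-- must contain e, since C and D contain none. Under (i), a cycle of C′ spliced into the cycle of (i)
-- yields a cycle in C, and a cocycle of D′ would meet the cycle of (i) only in e. Under (ii), a cycle
-- of C′ would meet the cocycle of (ii) only in f, and a cocycle of D′ forces D itself to disconnect G.
-- The properties transfer because C ∪ {f} = C′ ∪ {e} and D ∪ {e} = D′ ∪ {f}. The existence of cycles
-- and cocycles is obtained under double negation, which suffices as they are only used to reach ⊥.

module Submission where

open import Defs
open import Data.Bool.Properties using (T-≡)
open import Data.Empty using (⊥; ⊥-elim)
open import Data.Fin using (Fin; zero; suc; toℕ; fromℕ; fromℕ<; inject₁; _≟_)
open import Data.Fin.Properties using (toℕ-injective; toℕ<n; toℕ-fromℕ; fromℕ<-toℕ; toℕ-fromℕ<; toℕ-inject₁; inject₁-injective; any?)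
open import Data.Fin.Subset using (Subset; _∈_; _∉_; _⊆_; _⊂_; _∪_; _─_; _-_; ⁅_⁆; ∁; ⊤; ∣_∣; outside)
open import Data.Fin.Subset.Properties using (x∈p∪q⁻; x∈p∪q⁺; x∈⁅x⁆; x∈⁅y⁆⇒x≡y; x∉⁅y⁆⇒x≢y; x∈p∧x∉q⇒x∈p─q; p─q⊆p; x∈p∧x≢y⇒x∈p-y; x∉p⇒x∈∁p; x∈∁p⇒x∉p; ∈⊤; _∈?_; p⊂q⇒∣p∣<∣q∣)
open import Data.Nat as ℕ using (ℕ; zero; suc; _+_; _≤_; _<_; _≤′_; ≤′-refl; ≤′-step; z≤n; s≤s)
open import Data.Nat.Induction using (<-wellFounded)
open import Data.Nat.Properties using (≤⇒≤′; ≤′⇒≤; ≤-trans; <⇒≤; ≤-pred; ≰⇒>; ≤-antisym; <-cmp; +-suc; +-assoc; +-comm; +-monoˡ-<; m≤m+n; m<m+n; m≤n⇒∃[o]m+o≡n; _≤?_; n≤1+n; 1+n≰n; m<n⇒m<1+n; n<1+n; <⇒≢; m≢1+n+m)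
open import Data.Product using (Σ; ∃; _×_; _,_; proj₁; proj₂)
open import Data.Sum as Sum using (_⊎_; inj₁; inj₂; [_,_]′)
open import Data.Vec.Base using (_∷_; here; there; tabulate)
open import Data.Vec.Properties using (lookup∘tabulate; []=⇒lookup; lookup⇒[]=)
open import Function.Base using (id; _∘_)
open import Function.Bundles using (Equivalence)
open import Induction.WellFounded using (Acc; acc)
open import Relation.Binary using (tri<; tri≈; tri>)
open import Relation.Binary.Construct.Closure.ReflexiveTransitive using (Star; ε; _◅_; _◅◅_; gmap; reverse; kleisliStar)
open import Relation.Binary.PropositionalEquality using (_≡_; _≢_; refl; sym; trans; cong; subst; subst₂)
open import Relation.Nullary using (¬_; yes; no)
open import Relation.Nullary.Decidable using (¬¬-excluded-middle; isYes; toWitness; fromWitness; toSum)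

x∈p─q⇒x∉q : ∀ {n} {p q : Subset n} {x} → x ∈ p ─ q → x ∉ q
x∈p─q⇒x∉q {p = _ ∷ p} {outside ∷ q} here       ()
x∈p─q⇒x∉q {p = _ ∷ p} {_       ∷ q} (there x∈) (there x∈q) = x∈p─q⇒x∉q {p = p} {q} x∈ x∈q

module _ {n : ℕ} where

  x∈∁[p-y]⇒x∈∁p⊎x≡y : ∀ {p : Subset n} {x y} → x ∈ ∁ (p - y) → x ∈ ∁ p ⊎ x ≡ y
  x∈∁[p-y]⇒x∈∁p⊎x≡y {x = x} {y} x∈ with x ≟ y
  ... | yes x≡y = inj₂ x≡y
  ... | no x≢y  = inj₁ (x∉p⇒x∈∁p (λ x∈p → x∈∁p⇒x∉p x∈ (x∈p∧x≢y⇒x∈p-y x∈p x≢y)))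

  x∈p∪⁅y⁆⁻ : ∀ {p : Subset n} {x y} → x ∈ p ∪ ⁅ y ⁆ → x ∈ p ⊎ x ≡ y
  x∈p∪⁅y⁆⁻ {p} {y = y} x∈ = Sum.map₂ (x∈⁅y⁆⇒x≡y y) (x∈p∪q⁻ p ⁅ y ⁆ x∈)

  x∈p∪⁅y⁆⁺ : ∀ {p : Subset n} {x y} → x ∈ p ⊎ x ≡ y → x ∈ p ∪ ⁅ y ⁆
  x∈p∪⁅y⁆⁺ (inj₁ x∈p)  = x∈p∪q⁺ (inj₁ x∈p)
  x∈p∪⁅y⁆⁺ (inj₂ refl) = x∈p∪q⁺ (inj₂ (x∈⁅x⁆ _))

  ⊆p∪⁅x⁆⇒x∈ : ∀ {Q : Subset n → Set} {p S : Subset n} {x} → ¬ (Σ (Subset n) λ T → Q T × T ⊆ p)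
             → Q S → S ⊆ p ∪ ⁅ x ⁆ → x ∈ S
  ⊆p∪⁅x⁆⇒x∈ {S = S} {x} ¬Q⊆p QS S⊆p∪x with x ∈? S
  ... | yes x∈S = x∈S
  ... | no x∉S  = ⊥-elim (¬Q⊆p (S , QS , λ y∈S →
    [ id , (λ { refl → ⊥-elim (x∉S y∈S) }) ]′ (x∈p∪⁅y⁆⁻ (S⊆p∪x y∈S))))

  ∄[p─q]⇒p⊆q : ∀ {p q : Subset n} → ¬ (∃ λ x → x ∈ p × x ∉ q) → p ⊆ q
  ∄[p─q]⇒p⊆q {q = q} ∄ {x} x∈p with x ∈? q
  ... | yes x∈q = x∈q
  ... | no x∉q  = ⊥-elim (∄ (x , x∈p , x∉q))

image : ∀ {m n} → (Fin m → Fin n) → Subset n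
image g = tabulate λ y → isYes (any? λ i → g i ≟ y)

module _ {m n : ℕ} {g : Fin m → Fin n} where

  ∈image⁻ : ∀ {y} → y ∈ image g → ∃ λ i → g i ≡ y
  ∈image⁻ {y} y∈ = toWitness {a? = any? λ i → g i ≟ y}
    (Equivalence.from T-≡ (trans (sym (lookup∘tabulate _ y)) ([]=⇒lookup y∈)))

  ∈image⁺ : ∀ i → g i ∈ image g
  ∈image⁺ i = lookup⇒[]= (g i) (image g)
    (trans (lookup∘tabulate _ (g i)) (Equivalence.to T-≡ (fromWitness (i , refl))))

-- Beyond n the value is the junk f zero.
extend : ∀ {A : Set} {n} → (Fin (suc n) → A) → ℕ → A
extend {n = n} f t with t ℕ.<? suc n
... | yes t<1+n = f (fromℕ< t<1+n)
... | no _      = f zero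

extend-toℕ : ∀ {A : Set} {n} (f : Fin (suc n) → A) (j : Fin (suc n)) → extend f (toℕ j) ≡ f j
extend-toℕ {n = n} f j with toℕ j ℕ.<? suc n
... | yes j<1+n = cong f (fromℕ<-toℕ j j<1+n)
... | no j≮1+n  = ⊥-elim (j≮1+n (toℕ<n j))

Star-along : ∀ {A : Set} {R : A → A → Set} (W : ℕ → A) {a b} → a ≤ b
           → (∀ {t} → a ≤ t → t < b → R (W t) (W (suc t))) → Star R (W a) (W b)
Star-along {R = R} W a≤b = along (≤⇒≤′ a≤b)
  where
  along : ∀ {a b} → a ≤′ b → (∀ {t} → a ≤ t → t < b → R (W t) (W (suc t))) → Star R (W a) (W b)
  along ≤′-refl        steps = ε
  along (≤′-step a≤′b) steps =
    along a≤′b (λ a≤t t<b → steps a≤t (m<n⇒m<1+n t<b)) ◅◅ (steps (≤′⇒≤ a≤′b) (n<1+n _) ◅ ε)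

module _ (G : Graph) where

  Vertex Edge : Set
  Vertex = Fin (nV G)
  Edge   = Fin (nE G)

  end₁ end₂ : Edge → Vertex
  end₁ x = proj₁ (ends G x)
  end₂ x = proj₂ (ends G x)

  Step : (Edge → Set) → Vertex → Vertex → Set
  Step P u v = Σ Edge λ e → P e × Joins G e u v

  Reach : (Edge → Set) → Vertex → Vertex → Set
  Reach P = Star (Step P)

  Bypass : (Edge → Set) → Edge → Set
  Bypass P x = Reach P (end₁ x) (end₂ x)

  Joins-sym : ∀ {e u v} → Joins G e u v → Joins G e v u
  Joins-sym (inj₁ e≡) = inj₂ e≡
  Joins-sym (inj₂ e≡) = inj₁ e≡

  Joins⇒ends : ∀ {e u v} → Joins G e u v → (u ≡ end₁ e × v ≡ end₂ e) ⊎ (u ≡ end₂ e × v ≡ end₁ e)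
  Joins⇒ends (inj₁ e≡) = inj₁ (sym (cong proj₁ e≡) , sym (cong proj₂ e≡))
  Joins⇒ends (inj₂ e≡) = inj₂ (sym (cong proj₂ e≡) , sym (cong proj₁ e≡))

  Reach-mono : ∀ {P Q : Edge → Set} → (∀ {e} → P e → Q e) → ∀ {u v} → Reach P u v → Reach Q u v
  Reach-mono P⇒Q = gmap id λ { (e , Pe , j) → e , P⇒Q Pe , j }

  Reach-sym : ∀ {P u v} → Reach P u v → Reach P v u
  Reach-sym = reverse λ { (e , Pe , j) → e , Pe , Joins-sym j }

  Bypass-edge : ∀ {P : Edge → Set} {x} → P x → Bypass P x
  Bypass-edge {x = x} Px = (x , Px , inj₁ refl) ◅ ε

  Reach-reroute : ∀ {P Q : Edge → Set} {x} → (∀ {e} → P e → Q e ⊎ e ≡ x) → Bypass Q x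
                → ∀ {u v} → Reach P u v → Reach Q u v
  Reach-reroute {P} {Q} P⊆Q+x bypass = kleisliStar id reroute
    where
    reroute : ∀ {u v} → Step P u v → Reach Q u v
    reroute (e , Pe , j) with P⊆Q+x Pe
    ... | inj₁ Qe = (e , Qe , j) ◅ ε
    ... | inj₂ refl with Joins⇒ends j
    ...   | inj₁ (refl , refl) = bypass
    ...   | inj₂ (refl , refl) = Reach-sym bypass

  ConnectedIn-reroute : ∀ {A B : EdgeSet G} {x} → (∀ {e} → e ∈ A → e ∈ B ⊎ e ≡ x) → Bypass (_∈ B) x
                      → ConnectedIn G A → ConnectedIn G B
  ConnectedIn-reroute A⊆B+x bypass connA u v = Reach-reroute A⊆B+x bypass (connA u v)

  ReachesEndOf : (Edge → Set) → Edge → Vertex → Set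
  ReachesEndOf Q x u = Reach Q u (end₁ x) ⊎ Reach Q u (end₂ x)

  -- Traversing x only switches between its two ends.
  ReachesEndOf-transport : ∀ {P Q : Edge → Set} {x} → (∀ {e} → P e → Q e ⊎ e ≡ x)
                         → ∀ {u v} → Reach P u v → ReachesEndOf Q x u → ReachesEndOf Q x v
  ReachesEndOf-transport P⊆Q+x ε r = r
  ReachesEndOf-transport P⊆Q+x ((e , Pe , j) ◅ walk) r with P⊆Q+x Pe
  ... | inj₁ Qe = ReachesEndOf-transport P⊆Q+x walk (Sum.map (back ◅_) (back ◅_) r)
    where back = e , Qe , Joins-sym j
  ... | inj₂ refl with Joins⇒ends j
  ...   | inj₁ (refl , refl) = ReachesEndOf-transport P⊆Q+x walk (inj₂ ε)
  ...   | inj₂ (refl , refl) = ReachesEndOf-transport P⊆Q+x walk (inj₁ ε)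

  -- The rest of the cycle, from the far end of x (position m + 1) round to its near end (position m).
  cycle⇒Bypass : ∀ {Y} → IsCycle G Y → ∀ {x} → x ∈ Y → Bypass (λ y → y ∈ Y × y ≢ x) x
  cycle⇒Bypass {Y} (k , vs , es , es-injective , _ , closes , joins , covers , es∈Y) {x} x∈Y
    with covers x x∈Y
  ... | i , refl = orient (Joins⇒ends x-joins)
    where
    P : Edge → Set
    P y = y ∈ Y × y ≢ es i
    m : ℕ
    m = toℕ i

    W : ℕ → Vertex
    W = extend vs
    W-toℕ : ∀ (j : Fin (suc (suc k))) {t} → toℕ j ≡ t → W t ≡ vs j
    W-toℕ j refl = extend-toℕ vs j

    m<1+k : m < suc k
    m<1+k = toℕ<n i

    step-around : ∀ {t} → t < suc k → t ≢ m → Step P (W t) (W (suc t))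
    step-around {t} t<1+k t≢m =
      es j , (es∈Y j , es-j≢x) , subst₂ (Joins G (es j)) (sym W-t≡) (sym W-1+t≡) (joins j)
      where
      j : Fin (suc k)
      j = fromℕ< t<1+k
      toℕ-j : toℕ j ≡ t
      toℕ-j = toℕ-fromℕ< t<1+k
      es-j≢x : es j ≢ es i
      es-j≢x eq = t≢m (trans (sym toℕ-j) (cong toℕ (es-injective eq)))
      W-t≡ : W t ≡ vs (inject₁ j)
      W-t≡ = W-toℕ (inject₁ j) (trans (toℕ-inject₁ j) toℕ-j)
      W-1+t≡ : W (suc t) ≡ vs (suc j)
      W-1+t≡ = W-toℕ (suc j) (cong suc toℕ-j)

    up-to-m : Reach P (W 0) (W m)
    up-to-m = Star-along W z≤n λ _ t<m → step-around (≤-trans (m<n⇒m<1+n t<m) m<1+k) (<⇒≢ t<m)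
    from-m : Reach P (W (suc m)) (W (suc k))
    from-m = Star-along W m<1+k λ m<t t<1+k → step-around t<1+k (λ t≡m → <⇒≢ m<t (sym t≡m))
    W-1+k≡W-0 : W (suc k) ≡ W 0
    W-1+k≡W-0 = trans (W-toℕ (fromℕ (suc k)) (toℕ-fromℕ (suc k))) (trans closes (sym (W-toℕ zero refl)))
    around : Reach P (W (suc m)) (W m)
    around = subst (Reach P (W (suc m))) W-1+k≡W-0 from-m ◅◅ up-to-m

    x-joins : Joins G (es i) (W m) (W (suc m))
    x-joins = subst₂ (Joins G (es i)) (sym (W-toℕ (inject₁ i) (toℕ-inject₁ i))) (sym (W-toℕ (suc i) refl))
                (joins i)
    orient : (W m ≡ end₁ (es i) × W (suc m) ≡ end₂ (es i)) ⊎ (W m ≡ end₂ (es i) × W (suc m) ≡ end₁ (es i))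
           → Bypass P (es i)
    orient (inj₁ (W-m≡ , W-1+m≡)) = subst₂ (Reach P) W-m≡ W-1+m≡ (Reach-sym around)
    orient (inj₂ (W-m≡ , W-1+m≡)) = subst₂ (Reach P) W-1+m≡ W-m≡ around

  -- Walks are indexed by ℕ; vertices and edges past the length are junk.
  record Walk (P : Edge → Set) (u v : Vertex) : Set where
    field
      length : ℕ
      vertex : ℕ → Vertex
      edge   : ℕ → Edge
      starts : vertex 0 ≡ u
      stops  : vertex length ≡ v
      step   : ∀ t → t < length → P (edge t) × Joins G (edge t) (vertex t) (vertex (suc t))

  open Walk

  Reach⇒Walk : ∀ {P u v} → Edge → Reach P u v → Walk P u v
  Reach⇒Walk {u = u} filler ε = record
    { length = 0 ; vertex = λ _ → u ; edge = λ _ → filler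
    ; starts = refl ; stops = refl ; step = λ _ () }
  Reach⇒Walk {P} {u = u} filler ((e , Pe , j) ◅ rest) = record
    { length = suc (length w) ; vertex = vertex′ ; edge = edge′
    ; starts = refl ; stops = stops w ; step = step′ }
    where
    w = Reach⇒Walk filler rest
    vertex′ : ℕ → Vertex
    vertex′ zero    = u
    vertex′ (suc t) = vertex w t
    edge′ : ℕ → Edge
    edge′ zero    = e
    edge′ (suc t) = edge w t
    step′ : ∀ t → t < suc (length w) → P (edge′ t) × Joins G (edge′ t) (vertex′ t) (vertex′ (suc t))
    step′ zero    _         = Pe , subst (Joins G e u) (sym (starts w)) j
    step′ (suc t) (s≤s t<n) = step w t t<n

  step-cong : ∀ {P : Edge → Set} {e e′ a a′ b b′} → e ≡ e′ → a ≡ a′ → b ≡ b′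
            → P e′ × Joins G e′ a′ b′ → P e × Joins G e a b
  step-cong refl refl refl s = s

  Simple : ∀ {P u v} → Walk P u v → Set
  Simple w = ∀ s t → s ≤ length w → t ≤ length w → vertex w s ≡ vertex w t → s ≡ t

  Revisits : ∀ {P u v} → Walk P u v → Set
  Revisits w = Σ ℕ λ i → Σ ℕ λ d → i + suc d ≤ length w × vertex w i ≡ vertex w (i + suc d)

  Revisits⁺ : ∀ {P u v} (w : Walk P u v) {i j} → i < j → j ≤ length w → vertex w i ≡ vertex w j → Revisits w
  Revisits⁺ w {i} i<j j≤n eq with m≤n⇒∃[o]m+o≡n i<j
  ... | d , refl = i , d , subst (_≤ length w) i+1+d≡ j≤n , trans eq (cong (vertex w) i+1+d≡)
    where i+1+d≡ = sym (+-suc i d)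

  ¬Revisits⇒Simple : ∀ {P u v} (w : Walk P u v) → ¬ Revisits w → Simple w
  ¬Revisits⇒Simple w ¬rev s t s≤n t≤n s≡t with <-cmp s t
  ... | tri≈ _ s≡t′ _ = s≡t′
  ... | tri< s<t _ _  = ⊥-elim (¬rev (Revisits⁺ w s<t t≤n s≡t))
  ... | tri> _ _ t<s  = ⊥-elim (¬rev (Revisits⁺ w t<s s≤n (sym s≡t)))

  -- Cuts out the closed subwalk between positions i and i + 1 + d.
  module Shortcut {P u v} (w : Walk P u v) {i d} (i+1+d≤n : i + suc d ≤ length w)
                  (loop : vertex w i ≡ vertex w (i + suc d)) where

    r : ℕ
    r = proj₁ (m≤n⇒∃[o]m+o≡n i+1+d≤n)

    i+r+1+d≡n : i + r + suc d ≡ length w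
    i+r+1+d≡n = trans (+-assoc i r (suc d)) (trans (cong (i +_) (+-comm r (suc d)))
                  (trans (sym (+-assoc i (suc d) r)) (proj₂ (m≤n⇒∃[o]m+o≡n i+1+d≤n))))

    vertex′ : ℕ → Vertex
    vertex′ t with t ≤? i
    ... | yes _ = vertex w t
    ... | no _  = vertex w (t + suc d)

    edge′ : ℕ → Edge
    edge′ t with suc t ≤? i
    ... | yes _ = edge w t
    ... | no _  = edge w (t + suc d)

    vertex′-before : ∀ {t} → t ≤ i → vertex′ t ≡ vertex w t
    vertex′-before {t} t≤i with t ≤? i
    ... | yes _  = refl
    ... | no t≰i = ⊥-elim (t≰i t≤i)

    vertex′-after : ∀ {t} → i ≤ t → vertex′ t ≡ vertex w (t + suc d)
    vertex′-after {t} i≤t with t ≤? i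
    ... | yes t≤i = subst (λ s → vertex w s ≡ vertex w (s + suc d)) (≤-antisym i≤t t≤i) loop
    ... | no _    = refl

    edge′-before : ∀ {t} → t < i → edge′ t ≡ edge w t
    edge′-before {t} t<i with suc t ≤? i
    ... | yes _  = refl
    ... | no t≮i = ⊥-elim (t≮i t<i)

    edge′-after : ∀ {t} → ¬ t < i → edge′ t ≡ edge w (t + suc d)
    edge′-after {t} t≮i with suc t ≤? i
    ... | yes t<i = ⊥-elim (t≮i t<i)
    ... | no _    = refl

    step′ : ∀ t → t < i + r → P (edge′ t) × Joins G (edge′ t) (vertex′ t) (vertex′ (suc t))
    step′ t t<i+r = [ before , after ]′ (toSum (suc t ≤? i))
      where
      before : t < i → P (edge′ t) × Joins G (edge′ t) (vertex′ t) (vertex′ (suc t))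
      before t<i = step-cong {P = P} (edge′-before t<i) (vertex′-before (<⇒≤ t<i)) (vertex′-before t<i)
                     (step w t (≤-trans t<i (≤-trans (m≤m+n i (suc d)) i+1+d≤n)))
      after : ¬ t < i → P (edge′ t) × Joins G (edge′ t) (vertex′ t) (vertex′ (suc t))
      after t≮i = step-cong {P = P} (edge′-after t≮i) (vertex′-after i≤t) (vertex′-after (≤-trans i≤t (n≤1+n t)))
                    (step w (t + suc d) (subst (t + suc d <_) i+r+1+d≡n (+-monoˡ-< (suc d) t<i+r)))
        where i≤t = ≤-pred (≰⇒> t≮i)

    walk : Walk P u v
    walk = record
      { length = i + r ; vertex = vertex′ ; edge = edge′
      ; starts = trans (vertex′-before z≤n) (starts w)
      ; stops  = trans (vertex′-after (m≤m+n i r)) (trans (cong (vertex w) i+r+1+d≡n) (stops w))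
      ; step   = step′ }

    shorter : i + r < length w
    shorter = subst (i + r <_) i+r+1+d≡n (m<m+n (i + r) (s≤s z≤n))

  ¬¬Simple-walk : ∀ {P u v} → Walk P u v → ¬ ¬ Σ (Walk P u v) Simple
  ¬¬Simple-walk w = shorten w (<-wellFounded (length w))
    where
    shorten : ∀ {P u v} (w : Walk P u v) → Acc _<_ (length w) → ¬ ¬ Σ (Walk P u v) Simple
    shorten w (acc smaller) ¬simple = ¬¬-excluded-middle {A = Revisits w} λ
      { (yes (i , d , i+1+d≤n , loop)) →
          let open Shortcut w i+1+d≤n loop in shorten walk (smaller shorter) ¬simple
      ; (no ¬revisits) → ¬simple (w , ¬Revisits⇒Simple w ¬revisits) }

  Simple⇒¬reversed-steps : ∀ {P u v} (w : Walk P u v) → Simple w → ∀ {s t} → s < length w → t < length w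
                         → vertex w s ≡ vertex w (suc t) → vertex w (suc s) ≡ vertex w t → ⊥
  Simple⇒¬reversed-steps w simple {s} {t} s<n t<n vs≡ vs′≡ =
    m≢1+n+m t {1} (trans (sym (simple (suc s) t s<n (<⇒≤ t<n) vs′≡))
                         (cong suc (simple s (suc t) (<⇒≤ s<n) t<n vs≡)))

  Simple⇒edge-injective : ∀ {P u v} (w : Walk P u v) → Simple w
                        → ∀ {s t} → s < length w → t < length w → edge w s ≡ edge w t → s ≡ t
  Simple⇒edge-injective w simple {s} {t} s<n t<n es≡et
    with Joins⇒ends (proj₂ (step w s s<n))
       | Joins⇒ends (subst (λ e → Joins G e (vertex w t) (vertex w (suc t))) (sym es≡et)
                           (proj₂ (step w t t<n)))
  ... | inj₁ (s≡ , _) | inj₁ (t≡ , _) = simple s t (<⇒≤ s<n) (<⇒≤ t<n) (trans s≡ (sym t≡))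
  ... | inj₂ (s≡ , _) | inj₂ (t≡ , _) = simple s t (<⇒≤ s<n) (<⇒≤ t<n) (trans s≡ (sym t≡))
  ... | inj₁ (s≡ , s′≡) | inj₂ (t≡ , t′≡) =
    ⊥-elim (Simple⇒¬reversed-steps w simple s<n t<n (trans s≡ (sym t′≡)) (trans s′≡ (sym t≡)))
  ... | inj₂ (s≡ , s′≡) | inj₁ (t≡ , t′≡) =
    ⊥-elim (Simple⇒¬reversed-steps w simple s<n t<n (trans s≡ (sym t′≡)) (trans s′≡ (sym t≡)))

  closed-walk⇒cycle : ∀ {P u} (w : Walk P u u) {k} → length w ≡ suc k
                    → (∀ {s t} → s < length w → t < length w → vertex w s ≡ vertex w t → s ≡ t)
                    → (∀ {s t} → s < length w → t < length w → edge w s ≡ edge w t → s ≡ t)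
                    → Σ (EdgeSet G) λ S → IsCycle G S × (∀ {e} → e ∈ S → P e)
  closed-walk⇒cycle {P} w {k} n≡1+k vertex-injective edge-injective =
    image es , (k , vs , es , es-injective , vs-injective , closes , joins , (λ _ → ∈image⁻) , ∈image⁺) , ∈S⇒P
    where
    vs : Fin (suc (suc k)) → Vertex
    vs j = vertex w (toℕ j)
    es : Fin (suc k) → Edge
    es j = edge w (toℕ j)

    toℕ<length : (j : Fin (suc k)) → toℕ j < length w
    toℕ<length j = subst (toℕ j <_) (sym n≡1+k) (toℕ<n j)

    es-injective : ∀ {i j} → es i ≡ es j → i ≡ j
    es-injective eq = toℕ-injective (edge-injective (toℕ<length _) (toℕ<length _) eq)

    vs-injective : ∀ {i j} → vs (inject₁ i) ≡ vs (inject₁ j) → i ≡ j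
    vs-injective {i} {j} eq = inject₁-injective (toℕ-injective
      (vertex-injective (subst (_< length w) (sym (toℕ-inject₁ i)) (toℕ<length i))
                        (subst (_< length w) (sym (toℕ-inject₁ j)) (toℕ<length j)) eq))

    closes : vs (fromℕ (suc k)) ≡ vs zero
    closes = trans (cong (vertex w) (trans (toℕ-fromℕ (suc k)) (sym n≡1+k))) (trans (stops w) (sym (starts w)))

    joins : (j : Fin (suc k)) → Joins G (es j) (vs (inject₁ j)) (vs (suc j))
    joins j = subst (λ t → Joins G (es j) (vertex w t) (vs (suc j))) (sym (toℕ-inject₁ j))
                (proj₂ (step w _ (toℕ<length j)))

    ∈S⇒P : ∀ {e} → e ∈ image es → P e
    ∈S⇒P e∈ with ∈image⁻ e∈
    ... | j , refl = proj₁ (step w _ (toℕ<length j))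

  module Closing {P : Edge → Set} {x : Edge} (w : Walk P (end₁ x) (end₂ x)) where

    N : ℕ
    N = length w

    vertex′ : ℕ → Vertex
    vertex′ t with t ≤? N
    ... | yes _ = vertex w t
    ... | no _  = end₁ x

    edge′ : ℕ → Edge
    edge′ t with suc t ≤? N
    ... | yes _ = edge w t
    ... | no _  = x

    vertex′-≤ : ∀ {t} → t ≤ N → vertex′ t ≡ vertex w t
    vertex′-≤ {t} t≤N with t ≤? N
    ... | yes _  = refl
    ... | no t≰N = ⊥-elim (t≰N t≤N)

    vertex′-1+N : vertex′ (suc N) ≡ end₁ x
    vertex′-1+N with suc N ≤? N
    ... | yes 1+N≤N = ⊥-elim (1+n≰n 1+N≤N)
    ... | no _      = refl

    edge′-< : ∀ {t} → t < N → edge′ t ≡ edge w t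
    edge′-< {t} t<N with suc t ≤? N
    ... | yes _  = refl
    ... | no t≮N = ⊥-elim (t≮N t<N)

    edge′-≮ : ∀ {t} → ¬ t < N → edge′ t ≡ x
    edge′-≮ {t} t≮N with suc t ≤? N
    ... | yes t<N = ⊥-elim (t≮N t<N)
    ... | no _    = refl

    step′ : ∀ t → t < suc N → (P (edge′ t) ⊎ edge′ t ≡ x) × Joins G (edge′ t) (vertex′ t) (vertex′ (suc t))
    step′ t (s≤s t≤N) = [ inner , last ]′ (toSum (suc t ≤? N))
      where
      inner : t < N → (P (edge′ t) ⊎ edge′ t ≡ x) × Joins G (edge′ t) (vertex′ t) (vertex′ (suc t))
      inner t<N = step-cong {P = λ e → P e ⊎ e ≡ x} (edge′-< t<N) (vertex′-≤ t≤N) (vertex′-≤ t<N)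
                    (inj₁ (proj₁ (step w t t<N)) , proj₂ (step w t t<N))
      last : ¬ t < N → (P (edge′ t) ⊎ edge′ t ≡ x) × Joins G (edge′ t) (vertex′ t) (vertex′ (suc t))
      last t≮N with ≤-antisym t≤N (≤-pred (≰⇒> t≮N))
      ... | refl = step-cong {P = λ e → P e ⊎ e ≡ x} (edge′-≮ t≮N) (trans (vertex′-≤ t≤N) (stops w))
                     vertex′-1+N (inj₂ refl , inj₂ refl)

    walk : Walk (λ e → P e ⊎ e ≡ x) (end₁ x) (end₁ x)
    walk = record
      { length = suc N ; vertex = vertex′ ; edge = edge′
      ; starts = trans (vertex′-≤ z≤n) (starts w) ; stops = vertex′-1+N ; step = step′ }

    vertex-injective : Simple w → ∀ {s t} → s < suc N → t < suc N → vertex′ s ≡ vertex′ t → s ≡ t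
    vertex-injective simple (s≤s s≤N) (s≤s t≤N) eq =
      simple _ _ s≤N t≤N (trans (sym (vertex′-≤ s≤N)) (trans eq (vertex′-≤ t≤N)))

    edge-injective : (∀ {e} → P e → e ≢ x) → Simple w
                   → ∀ {s t} → s < suc N → t < suc N → edge′ s ≡ edge′ t → s ≡ t
    edge-injective P⇒≢x simple {s} {t} (s≤s s≤N) (s≤s t≤N) eq with suc s ≤? N | suc t ≤? N
    ... | yes s<N | yes t<N = Simple⇒edge-injective w simple s<N t<N eq
    ... | yes s<N | no _    = ⊥-elim (P⇒≢x (proj₁ (step w s s<N)) eq)
    ... | no _    | yes t<N = ⊥-elim (P⇒≢x (proj₁ (step w t t<N)) (sym eq))
    ... | no s≮N  | no t≮N  =
      trans (≤-antisym s≤N (≤-pred (≰⇒> s≮N))) (sym (≤-antisym t≤N (≤-pred (≰⇒> t≮N))))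

  Simple-bypass⇒cycle : ∀ {P : Edge → Set} {x} → (∀ {e} → P e → e ≢ x)
                      → (w : Walk P (end₁ x) (end₂ x)) → Simple w
                      → Σ (EdgeSet G) λ S → IsCycle G S × (∀ {e} → e ∈ S → P e ⊎ e ≡ x)
  Simple-bypass⇒cycle P⇒≢x w simple =
    closed-walk⇒cycle walk refl (vertex-injective simple) (edge-injective P⇒≢x simple)
    where open Closing w

  Bypass⇒¬¬cycle : ∀ {P : Edge → Set} {x} → (∀ {e} → P e → e ≢ x) → Bypass P x
                 → ¬ ¬ Σ (EdgeSet G) λ S → IsCycle G S × (∀ {e} → e ∈ S → P e ⊎ e ≡ x)
  Bypass⇒¬¬cycle {x = x} P⇒≢x bypass ¬cycle =
    ¬¬Simple-walk (Reach⇒Walk x bypass) λ (w , simple) → ¬cycle (Simple-bypass⇒cycle P⇒≢x w simple)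

  cocycle-minimal : ∀ {S} → IsCocycle G S → ∀ {x} → x ∈ S → ¬ Disconnects G (S - x)
  cocycle-minimal {S} (_ , minimal) {x} x∈S disconnects =
    x∈p─q⇒x∉q {p = S} (minimal (S - x) (p─q⊆p S ⁅ x ⁆) disconnects x∈S) (x∈⁅x⁆ x)

  Disconnects⇒¬¬cocycle : ∀ X → Disconnects G X → ¬ ¬ ContainsCocycle G X
  Disconnects⇒¬¬cocycle X = shrink X (<-wellFounded ∣ X ∣)
    where
    shrink : ∀ X → Acc _<_ ∣ X ∣ → Disconnects G X → ¬ ¬ ContainsCocycle G X
    shrink X (acc smaller) disconnects ¬cocycle =
      ¬¬-excluded-middle {A = Σ (EdgeSet G) λ Y → Y ⊂ X × Disconnects G Y} λ
        { (yes (Y , Y⊂X , disconnectsY)) →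
            shrink Y (smaller (p⊂q⇒∣p∣<∣q∣ Y⊂X)) disconnectsY λ (S , cocycle , S⊆Y) →
              ¬cocycle (S , cocycle , λ e∈S → proj₁ Y⊂X (S⊆Y e∈S))
        ; (no ¬proper) → ¬cocycle (X , (disconnects , λ Y Y⊆X disconnectsY → ∄[p─q]⇒p⊆q λ (z , z∈X , z∉Y) →
            ¬proper (Y , (Y⊆X , z , z∈X , z∉Y) , disconnectsY)) , λ e∈X → e∈X) }

  cycle∩cocycle≢singleton : ∀ x {Y S} → IsCycle G Y → IsCocycle G S → x ∈ Y → x ∈ S
                          → ¬ (∀ {y} → y ∈ Y → y ∈ S → y ≡ x)
  cycle∩cocycle≢singleton x {Y} {S} cycle cocycle x∈Y x∈S Y∩S⊆x =
    cocycle-minimal cocycle x∈S λ connected →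
      proj₁ cocycle (ConnectedIn-reroute x∈∁[p-y]⇒x∈∁p⊎x≡y bypass connected)
    where
    bypass : Bypass (_∈ ∁ S) x
    bypass = Reach-mono (λ (y∈Y , y≢x) → x∉p⇒x∈∁p λ y∈S → y≢x (Y∩S⊆x y∈Y y∈S)) (cycle⇒Bypass cycle x∈Y)

module _ {G : Graph} {H C : EdgeSet G} where

  ∈DeletingSet⁻ : ∀ {x} → x ∈ DeletingSet G H C → x ∉ C × x ∉ H
  ∈DeletingSet⁻ x∈D = (λ x∈C → x∈p─q⇒x∉q x∈D (x∈p∪q⁺ (inj₁ x∈C)))
                    , (λ x∈H → x∈p─q⇒x∉q x∈D (x∈p∪q⁺ (inj₂ x∈H)))

  ∈DeletingSet⁺ : ∀ {x} → x ∉ C → x ∉ H → x ∈ DeletingSet G H C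
  ∈DeletingSet⁺ x∉C x∉H = x∈p∧x∉q⇒x∈p─q ∈⊤ λ x∈C∪H → [ x∉C , x∉H ]′ (x∈p∪q⁻ C H x∈C∪H)

  ∉DeletingSet⁻ : ∀ {x} → x ∉ DeletingSet G H C → x ∈ C ⊎ x ∈ H
  ∉DeletingSet⁻ {x} x∉D with x ∈? C ∪ H
  ... | yes x∈C∪H = x∈p∪q⁻ C H x∈C∪H
  ... | no x∉C∪H  = ⊥-elim (x∉D (x∈p∧x∉q⇒x∈p─q ∈⊤ x∉C∪H))

module _ {G : Graph} {C : EdgeSet G} {e f : Edge G} where

  ∈Exchange⁻ : ∀ {x} → x ∈ Exchange G C e f → x ≡ f ⊎ (x ∈ C × x ≢ e)
  ∈Exchange⁻ x∈C′ with x∈p∪q⁻ ⁅ f ⁆ (C - e) x∈C′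
  ... | inj₁ x∈⁅f⁆   = inj₁ (x∈⁅y⁆⇒x≡y f x∈⁅f⁆)
  ... | inj₂ x∈C-e = inj₂ (p─q⊆p C ⁅ e ⁆ x∈C-e , x∉⁅y⁆⇒x≢y (x∈p─q⇒x∉q {p = C} x∈C-e))

  f∈Exchange : f ∈ Exchange G C e f
  f∈Exchange = x∈p∪q⁺ (inj₁ (x∈⁅x⁆ f))

  ∈Exchange⁺ : ∀ {x} → x ∈ C → x ≢ e → x ∈ Exchange G C e f
  ∈Exchange⁺ x∈C x≢e = x∈p∪q⁺ (inj₂ (x∈p∧x≢y⇒x∈p-y x∈C x≢e))

module Exchange {G : Graph} {H C : EdgeSet G} (C-avoids-H : C ⊆ ⊤ ─ H) (C-acyclic : ¬ ContainsCycle G C)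
                (D-cocycle-free : ¬ ContainsCocycle G (DeletingSet G H C))
                {e f : Edge G} (e∈C : e ∈ C) (f∈D : f ∈ DeletingSet G H C) where

  D C′ D′ : EdgeSet G
  D  = DeletingSet G H C
  C′ = Exchange G C e f
  D′ = DeletingSet G H C′

  ∈D⁻ : ∀ {x} → x ∈ D → x ∉ C × x ∉ H
  ∈D⁻ = ∈DeletingSet⁻ {G} {H} {C}
  ∈D⁺ : ∀ {x} → x ∉ C → x ∉ H → x ∈ D
  ∈D⁺ = ∈DeletingSet⁺ {G} {H} {C}
  ∈D′⁻ : ∀ {x} → x ∈ D′ → x ∉ C′ × x ∉ H
  ∈D′⁻ = ∈DeletingSet⁻ {G} {H} {C′}
  ∈D′⁺ : ∀ {x} → x ∉ C′ → x ∉ H → x ∈ D′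
  ∈D′⁺ = ∈DeletingSet⁺ {G} {H} {C′}
  ∉D⁻ : ∀ {x} → x ∉ D → x ∈ C ⊎ x ∈ H
  ∉D⁻ = ∉DeletingSet⁻ {G} {H} {C}
  ∈C′⁻ : ∀ {x} → x ∈ C′ → x ≡ f ⊎ (x ∈ C × x ≢ e)
  ∈C′⁻ = ∈Exchange⁻ {G} {C} {e} {f}
  ∈C′⁺ : ∀ {x} → x ∈ C → x ≢ e → x ∈ C′
  ∈C′⁺ = ∈Exchange⁺ {G} {C} {e} {f}
  f∈C′ : f ∈ C′
  f∈C′ = f∈Exchange {G} {C} {e} {f}

  e∉H : e ∉ H
  e∉H = x∈p─q⇒x∉q (C-avoids-H e∈C)

  f∉C : f ∉ C
  f∉C = proj₁ (∈D⁻ f∈D)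

  ∈C⇒∉D : ∀ {x} → x ∈ C → x ∉ D
  ∈C⇒∉D x∈C x∈D = proj₁ (∈D⁻ x∈D) x∈C

  ∈C′⇒∉D′ : ∀ {x} → x ∈ C′ → x ∉ D′
  ∈C′⇒∉D′ x∈C′ x∈D′ = proj₁ (∈D′⁻ x∈D′) x∈C′

  e∉C′ : e ∉ C′
  e∉C′ e∈C′ = [ (λ e≡f → f∉C (subst (_∈ C) e≡f e∈C)) , (λ (_ , e≢e) → e≢e refl) ]′ (∈C′⁻ e∈C′)

  C′⊆C∪⁅f⁆ : C′ ⊆ C ∪ ⁅ f ⁆
  C′⊆C∪⁅f⁆ x∈C′ = x∈p∪⁅y⁆⁺ ([ inj₂ , (λ (x∈C , _) → inj₁ x∈C) ]′ (∈C′⁻ x∈C′))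

  C∪⁅f⁆⊆C′∪⁅e⁆ : C ∪ ⁅ f ⁆ ⊆ C′ ∪ ⁅ e ⁆
  C∪⁅f⁆⊆C′∪⁅e⁆ {x} x∈C∪f with x ≟ e | x∈p∪⁅y⁆⁻ x∈C∪f
  ... | yes x≡e | _         = x∈p∪⁅y⁆⁺ (inj₂ x≡e)
  ... | no x≢e  | inj₁ x∈C  = x∈p∪⁅y⁆⁺ (inj₁ (∈C′⁺ x∈C x≢e))
  ... | no _    | inj₂ refl = x∈p∪⁅y⁆⁺ (inj₁ f∈C′)

  D′⊆D∪⁅e⁆ : D′ ⊆ D ∪ ⁅ e ⁆
  D′⊆D∪⁅e⁆ {x} x∈D′ with x ≟ e | ∈D′⁻ x∈D′
  ... | yes x≡e | _             = x∈p∪⁅y⁆⁺ (inj₂ x≡e)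
  ... | no x≢e  | x∉C′ , x∉H = x∈p∪⁅y⁆⁺ (inj₁ (∈D⁺ (λ x∈C → x∉C′ (∈C′⁺ x∈C x≢e)) x∉H))

  D∪⁅e⁆⊆D′∪⁅f⁆ : D ∪ ⁅ e ⁆ ⊆ D′ ∪ ⁅ f ⁆
  D∪⁅e⁆⊆D′∪⁅f⁆ {x} x∈D∪e with x ≟ f | x∈p∪⁅y⁆⁻ x∈D∪e
  ... | yes x≡f | _         = x∈p∪⁅y⁆⁺ (inj₂ x≡f)
  ... | no x≢f  | inj₁ x∈D  = x∈p∪⁅y⁆⁺ (inj₁ (∈D′⁺ x∉C′ (proj₂ (∈D⁻ x∈D))))
    where
    x∉C′ : x ∉ C′
    x∉C′ x∈C′ = [ x≢f , (λ (x∈C , _) → ∈C⇒∉D x∈C x∈D) ]′ (∈C′⁻ x∈C′)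
  ... | no _    | inj₂ refl = x∈p∪⁅y⁆⁺ (inj₁ (∈D′⁺ e∉C′ e∉H))

  C′-avoids-H : C′ ⊆ ⊤ ─ H
  C′-avoids-H x∈C′ with ∈C′⁻ x∈C′
  ... | inj₁ refl      = x∈p∧x∉q⇒x∈p─q ∈⊤ (proj₂ (∈D⁻ f∈D))
  ... | inj₂ (x∈C , _) = C-avoids-H x∈C

  cycle⊆C′⇒f∈ : ∀ {Y} → IsCycle G Y → Y ⊆ C′ → f ∈ Y
  cycle⊆C′⇒f∈ Y-cycle Y⊆C′ = ⊆p∪⁅x⁆⇒x∈ C-acyclic Y-cycle (λ y∈Y → C′⊆C∪⁅f⁆ (Y⊆C′ y∈Y))

  cocycle⊆D′⇒e∈ : ∀ {S} → IsCocycle G S → S ⊆ D′ → e ∈ S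
  cocycle⊆D′⇒e∈ S-cocycle S⊆D′ = ⊆p∪⁅x⁆⇒x∈ D-cocycle-free S-cocycle (λ y∈S → D′⊆D∪⁅e⁆ (S⊆D′ y∈S))

  -- The cycle of C′ through f gives a bypass of f in C - e; splicing it into the cycle of (i)
  -- gives a bypass of e in C - e, which closes a cycle in C.
  C′-acyclic-i : Property-i G C e f → ¬ ContainsCycle G C′
  C′-acyclic-i (Z , Z-cycle , Z⊆C∪f , e∈Z) (Y , Y-cycle , Y⊆C′) =
    Bypass⇒¬¬cycle G proj₂ e-bypass λ (S , S-cycle , S⊆C-e+e) →
      C-acyclic (S , S-cycle , λ x∈S → [ proj₁ , (λ { refl → e∈C }) ]′ (S⊆C-e+e x∈S))
    where
    f-bypass : Bypass G (λ y → y ∈ C × y ≢ e) f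
    f-bypass = Reach-mono G (λ (y∈Y , y≢f) → [ ⊥-elim ∘ y≢f , id ]′ (∈C′⁻ (Y⊆C′ y∈Y)))
                 (cycle⇒Bypass G Y-cycle (cycle⊆C′⇒f∈ Y-cycle Y⊆C′))
    e-bypass : Bypass G (λ y → y ∈ C × y ≢ e) e
    e-bypass = Reach-reroute G (λ (y∈Z , y≢e) → Sum.map₁ (_, y≢e) (x∈p∪⁅y⁆⁻ (Z⊆C∪f y∈Z))) f-bypass
                 (cycle⇒Bypass G Z-cycle e∈Z)

  C′-acyclic-ii : Property-ii G H C e f → ¬ ContainsCycle G C′
  C′-acyclic-ii (T , T-cocycle , T⊆D∪e , f∈T) (Y , Y-cycle , Y⊆C′) =
    cycle∩cocycle≢singleton G f Y-cycle T-cocycle (cycle⊆C′⇒f∈ Y-cycle Y⊆C′) f∈T Y∩T⊆f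
    where
    Y∩T⊆f : ∀ {y} → y ∈ Y → y ∈ T → y ≡ f
    Y∩T⊆f y∈Y y∈T with ∈C′⁻ (Y⊆C′ y∈Y) | x∈p∪⁅y⁆⁻ (T⊆D∪e y∈T)
    ... | inj₁ y≡f       | _        = y≡f
    ... | inj₂ (y∈C , _) | inj₁ y∈D = ⊥-elim (∈C⇒∉D y∈C y∈D)
    ... | inj₂ (_ , y≢e) | inj₂ y≡e = ⊥-elim (y≢e y≡e)

  D′-cocycle-free-i : Property-i G C e f → ¬ ContainsCocycle G D′
  D′-cocycle-free-i (Z , Z-cycle , Z⊆C∪f , e∈Z) (S , S-cocycle , S⊆D′) =
    cycle∩cocycle≢singleton G e Z-cycle S-cocycle e∈Z (cocycle⊆D′⇒e∈ S-cocycle S⊆D′) Z∩S⊆e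
    where
    Z∩S⊆e : ∀ {y} → y ∈ Z → y ∈ S → y ≡ e
    Z∩S⊆e y∈Z y∈S = [ (λ y∈C′ → ⊥-elim (∈C′⇒∉D′ y∈C′ (S⊆D′ y∈S))) , id ]′
                      (x∈p∪⁅y⁆⁻ (C∪⁅f⁆⊆C′∪⁅e⁆ (Z⊆C∪f y∈Z)))

  -- Suppose ∁D connected. Off D, only e can lie in S or T. Walk in ∁D from end₁ e to both ends of f:
  -- if they arrive at different ends of e, then f ∉ S completes a bypass of e avoiding S, so S does
  -- not disconnect; otherwise f has a bypass avoiding T, so T does not disconnect (by minimality of T).
  D′-cocycle-free-ii : Property-ii G H C e f → ¬ ContainsCocycle G D′
  D′-cocycle-free-ii (T , T-cocycle , T⊆D∪e , f∈T) (S , S-cocycle , S⊆D′) =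
    Disconnects⇒¬¬cocycle G D D-disconnects D-cocycle-free
    where
    Avoids : Edge G → Set
    Avoids y = y ∉ S × y ∉ T

    ∁D⊆Avoids∪e : ∀ {y} → y ∈ ∁ D → Avoids y ⊎ y ≡ e
    ∁D⊆Avoids∪e {y} y∈∁D with y ≟ e
    ... | yes y≡e = inj₂ y≡e
    ... | no y≢e  = inj₁ (y∉S , y∉T)
      where
      y∉D : y ∉ D
      y∉D = x∈∁p⇒x∉p y∈∁D
      y∉S : y ∉ S
      y∉S y∈S = [ (λ y∈C → ∈C′⇒∉D′ (∈C′⁺ y∈C y≢e) (S⊆D′ y∈S)) , proj₂ (∈D′⁻ (S⊆D′ y∈S)) ]′
                  (∉D⁻ y∉D)
      y∉T : y ∉ T
      y∉T y∈T = [ y∉D , y≢e ]′ (x∈p∪⁅y⁆⁻ (T⊆D∪e y∈T))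

    avoids-S : ∀ {y} → Avoids y → y ∈ ∁ S
    avoids-S (y∉S , _) = x∉p⇒x∈∁p y∉S
    avoids-T : ∀ {y} → Avoids y → y ∈ ∁ T
    avoids-T (_ , y∉T) = x∉p⇒x∈∁p y∉T

    e-bypass⇒⊥ : Bypass G (_∈ ∁ S) e → ConnectedIn G (∁ D) → ⊥
    e-bypass⇒⊥ bypass connected =
      proj₁ S-cocycle (ConnectedIn-reroute G (Sum.map₁ avoids-S ∘ ∁D⊆Avoids∪e) bypass connected)
    f-bypass⇒⊥ : Bypass G (_∈ ∁ T) f → ⊥
    f-bypass⇒⊥ bypass = cocycle-minimal G T-cocycle f∈T λ connected →
      proj₁ T-cocycle (ConnectedIn-reroute G x∈∁[p-y]⇒x∈∁p⊎x≡y bypass connected)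

    f∈∁S : f ∈ ∁ S
    f∈∁S = x∉p⇒x∈∁p λ f∈S → ∈C′⇒∉D′ f∈C′ (S⊆D′ f∈S)
    avoid-S : ∀ {u v} → Reach G Avoids u v → Reach G (_∈ ∁ S) u v
    avoid-S = Reach-mono G avoids-S
    avoid-T : ∀ {u v} → Reach G Avoids u v → Reach G (_∈ ∁ T) u v
    avoid-T = Reach-mono G avoids-T

    D-disconnects : Disconnects G D
    D-disconnects connected = arrive (reach (end₁ G f)) (reach (end₂ G f))
      where
      reach : ∀ v → ReachesEndOf G Avoids e v
      reach v = ReachesEndOf-transport G ∁D⊆Avoids∪e (connected (end₁ G e) v) (inj₁ ε)
      arrive : ReachesEndOf G Avoids e (end₁ G f) → ReachesEndOf G Avoids e (end₂ G f) → ⊥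
      arrive (inj₁ p) (inj₂ q) =
        e-bypass⇒⊥ (Reach-sym G (avoid-S p) ◅◅ Bypass-edge G f∈∁S ◅◅ avoid-S q) connected
      arrive (inj₂ p) (inj₁ q) =
        e-bypass⇒⊥ (Reach-sym G (avoid-S q) ◅◅ Reach-sym G (Bypass-edge G f∈∁S) ◅◅ avoid-S p) connected
      arrive (inj₁ p) (inj₁ q) = f-bypass⇒⊥ (avoid-T p ◅◅ Reach-sym G (avoid-T q))
      arrive (inj₂ p) (inj₂ q) = f-bypass⇒⊥ (avoid-T p ◅◅ Reach-sym G (avoid-T q))

  Property-i-swap : Property-i G C e f → Property-i G C′ f e
  Property-i-swap (Z , Z-cycle , Z⊆C∪f , _) =
    Z , Z-cycle , (λ y∈Z → C∪⁅f⁆⊆C′∪⁅e⁆ (Z⊆C∪f y∈Z)) , ⊆p∪⁅x⁆⇒x∈ C-acyclic Z-cycle Z⊆C∪f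

  Property-ii-swap : Property-ii G H C e f → Property-ii G H C′ f e
  Property-ii-swap (T , T-cocycle , T⊆D∪e , _) =
    T , T-cocycle , (λ y∈T → D∪⁅e⁆⊆D′∪⁅f⁆ (T⊆D∪e y∈T)) , ⊆p∪⁅x⁆⇒x∈ D-cocycle-free T-cocycle T⊆D∪e

lemma3p7 : (G : Graph) → Connected G → (H C : EdgeSet G) → IsContracting G H C
    → (e f : Fin (nE G)) → e ∈ C → f ∈ DeletingSet G H C
    → Property-i G C e f ⊎ Property-ii G H C e f
    → IsContracting G H (Exchange G C e f)
    × (Property-i G C e f → Property-i G (Exchange G C e f) f e)
    × (Property-ii G H C e f → Property-ii G H (Exchange G C e f) f e)
-- Connectivity of G is implied by the hypotheses: otherwise ∅ would be a cocycle inside D.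
lemma3p7 G _ H C (C-avoids-H , C-acyclic , D-cocycle-free) e f e∈C f∈D property =
  ( ( C′-avoids-H
    , [ C′-acyclic-i , C′-acyclic-ii ]′ property
    , [ D′-cocycle-free-i , D′-cocycle-free-ii ]′ property )
  , Property-i-swap
  , Property-ii-swap )
  where open Exchange C-avoids-H C-acyclic D-cocycle-free e∈C f∈D
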